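{- Let $\Pi$ be a 3-polygraph and $X$ a set of $3$-cells of $\Pi$. Assume there exists a compatible polygraphic interpretation $(\phi,\partial)$ of $\Pi$ which is strictly compatible with every $3$-cell of $X$. Then $\Pi$ terminates if and only if the 3-polygraph $\Pi-X$ (obtained by removing the $3$-cells of $X$) terminates.
   Context: A 3-polygraph freely generates a strict $3$-category whose $k$-morphisms are $k$-paths, composed by $\star_j$ ($0\le j<k$); $s_j,t_j$ are $j$-source/target. Elementary $3$-paths (containing exactly one $3$-cell) are rewriting steps from their $2$-source to their $2$-target; the polygraph terminates if there is no infinite sequence of such steps. A functorial interpretation $\phi$ assigns to each $1$-path $u$ with $n$ $1$-cells a nonempty $\phi(u)\subseteq(\mathbb{N}\setminus\{0\})^n$ and to each $2$-path $f:u\Rightarrow v$ a monotone map $\phi(f):\phi(u)\to\phi(v)$ (product order), with $\phi(u\star_0v)=\phi(u)\times\phi(v)$, $\phi(f\star_0g)=\phi(f)\times\phi(g)$, $\phi(f\star_1g)=\phi(g)\circ\phi(f)$, identities to identities. A differential interpretation $\partial$ over $\phi$ into $(\mathbb{N},+,0)$ assigns to each $2$-path $f$ with $1$-source $u$ a monotone $\partial f:\phi(u)\to\mathbb{N}$ with $\partial(\text{identity})=0$, $\partial(f\star_0g)(x,y)=\partial f(x)+\partial g(y)$, $\partial(f\star_1g)=\partial f+\partial g\circ\phi(f)$. A polygraphic interpretation is such a pair $(\phi,\partial)$; it is compatible (with a $3$-cell $\alpha$) if $\phi(s_2\alpha)\ge\phi(t_2\alpha)$ and $\partial(s_2\alpha)\ge\partial(t_2\alpha)$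 pointwise, strictly compatible with $\alpha$ if $\phi(s_2\alpha)\ge\phi(t_2\alpha)$ and $\partial(s_2\alpha)>\partial(t_2\alpha)$ pointwise; compatible means compatible with every $3$-cell. -}

module Defs where

open import Data.Nat using (ℕ; _+_; _≤_; _<_; _≥_; _>_)
open import Data.Unit using (⊤; tt)
open import Data.Product using (Σ; _×_; _,_; proj₁; proj₂)
open import Relation.Nullary using (¬_)
open import Relation.Binary.Construct.Closure.ReflexiveTransitive
  using (Star; ε; _◅_; _◅◅_)

record Polygraph2 : Set₁ where
  field
    C0 : Set
    C1 : C0 → C0 → Set
    C2 : ∀ {x y} → Star C1 x y → Star C1 x y → Set

module Free2 (P : Polygraph2) where
  open Polygraph2 P

  Path1 : C0 → C0 → Set
  Path1 = Star C1

  -- formal 2-path terms (free 2-category modulo _≈_ below)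
  data Path2 : ∀ {x y} → Path1 x y → Path1 x y → Set where
    gen   : ∀ {x y} {u v : Path1 x y} → C2 u v → Path2 u v
    id2   : ∀ {x y} (u : Path1 x y) → Path2 u u
    _⋆1_  : ∀ {x y} {u v w : Path1 x y} → Path2 u v → Path2 v w → Path2 u w
    _⋆0_  : ∀ {x y z} {u v : Path1 x y} {u' v' : Path1 y z} →
            Path2 u v → Path2 u' v' → Path2 (u ◅◅ u') (v ◅◅ v')

  infixl 6 _⋆1_
  infixl 7 _⋆0_

  record 2P : Set where
    constructor ⟪_⟫
    field
      {x y} : C0
      {u v} : Path1 x y
      path  : Path2 u v

  infix 4 _≈_
  data _≈_ : 2P → 2P → Set where
    ≈-refl  : ∀ {F} → F ≈ F
    ≈-sym   : ∀ {F G} → F ≈ G → G ≈ F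
    ≈-trans : ∀ {F G H} → F ≈ G → G ≈ H → F ≈ H
    cong⋆1  : ∀ {x y x' y'} {u v w : Path1 x y} {u' v' w' : Path1 x' y'}
              {f : Path2 u v} {g : Path2 v w} {f' : Path2 u' v'} {g' : Path2 v' w'} →
              ⟪ f ⟫ ≈ ⟪ f' ⟫ → ⟪ g ⟫ ≈ ⟪ g' ⟫ → ⟪ f ⋆1 g ⟫ ≈ ⟪ f' ⋆1 g' ⟫
    cong⋆0  : ∀ {x y z x' y' z'} {u v : Path1 x y} {p q : Path1 y z}
              {u' v' : Path1 x' y'} {p' q' : Path1 y' z'}
              {f : Path2 u v} {g : Path2 p q} {f' : Path2 u' v'} {g' : Path2 p' q'} →
              ⟪ f ⟫ ≈ ⟪ f' ⟫ → ⟪ g ⟫ ≈ ⟪ g' ⟫ → ⟪ f ⋆0 g ⟫ ≈ ⟪ f' ⋆0 g' ⟫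
    assoc1  : ∀ {x y} {u v w t : Path1 x y}
              {f : Path2 u v} {g : Path2 v w} {h : Path2 w t} →
              ⟪ (f ⋆1 g) ⋆1 h ⟫ ≈ ⟪ f ⋆1 (g ⋆1 h) ⟫
    unitl1  : ∀ {x y} {u v : Path1 x y} {f : Path2 u v} → ⟪ id2 u ⋆1 f ⟫ ≈ ⟪ f ⟫
    unitr1  : ∀ {x y} {u v : Path1 x y} {f : Path2 u v} → ⟪ f ⋆1 id2 v ⟫ ≈ ⟪ f ⟫
    assoc0  : ∀ {x y z t} {u v : Path1 x y} {p q : Path1 y z} {r s : Path1 z t}
              {f : Path2 u v} {g : Path2 p q} {h : Path2 r s} →
              ⟪ (f ⋆0 g) ⋆0 h ⟫ ≈ ⟪ f ⋆0 (g ⋆0 h) ⟫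
    unitl0  : ∀ {x y} {u v : Path1 x y} {f : Path2 u v} → ⟪ id2 (ε {x = x}) ⋆0 f ⟫ ≈ ⟪ f ⟫
    unitr0  : ∀ {x y} {u v : Path1 x y} {f : Path2 u v} → ⟪ f ⋆0 id2 (ε {x = y}) ⟫ ≈ ⟪ f ⟫
    id⋆0    : ∀ {x y z} {u : Path1 x y} {v : Path1 y z} →
              ⟪ id2 u ⋆0 id2 v ⟫ ≈ ⟪ id2 (u ◅◅ v) ⟫
    exch    : ∀ {x y z} {u v w : Path1 x y} {p q r : Path1 y z}
              {f : Path2 u v} {f' : Path2 v w} {g : Path2 p q} {g' : Path2 q r} →
              ⟪ (f ⋆0 g) ⋆1 (f' ⋆0 g') ⟫ ≈ ⟪ (f ⋆1 f') ⋆0 (g ⋆1 g') ⟫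

  whisk : ∀ {x' x y y'} (w : Path1 x' x) {u v : Path1 x y} →
          Path2 u v → (w' : Path1 y y') → Path2 (w ◅◅ u ◅◅ w') (w ◅◅ v ◅◅ w')
  whisk w f w' = id2 w ⋆0 (f ⋆0 id2 w')

record Polygraph3 : Set₁ where
  field
    P2 : Polygraph2
    C3 : ∀ {x y} {u v : Free2.Path1 P2 x y} →
         Free2.Path2 P2 u v → Free2.Path2 P2 u v → Set

module _ (Π : Polygraph3) where
  open Polygraph3 Π
  open Polygraph2 P2
  open Free2 P2

  record Cell3 : Set where
    constructor cell
    field
      {x y} : C0
      {u v} : Path1 x y
      {s t} : Path2 u v
      α     : C3 s t

  -- rewriting step F ⇛ G : there is an elementary 3-path
  --   h ⋆1 (w ⋆0 α ⋆0 w') ⋆1 k  with 2-source F and 2-target G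
  record Step (F G : 2P) : Set where
    field
      {x' x y y'} : C0
      {u v}       : Path1 x y
      {s t}       : Path2 u v
      α           : C3 s t
      w           : Path1 x' x
      w'          : Path1 y y'
      {r r'}      : Path1 x' y'
      h           : Path2 r (w ◅◅ u ◅◅ w')
      k           : Path2 (w ◅◅ v ◅◅ w') r'
      src≈        : F ≈ ⟪ h ⋆1 whisk w s w' ⋆1 k ⟫
      tgt≈        : G ≈ ⟪ h ⋆1 whisk w t w' ⋆1 k ⟫

  Terminates : Set
  Terminates = ¬ (Σ (ℕ → 2P) λ f → ∀ n → Step (f n) (f (Data.Nat.suc n)))

_−_ : (Π : Polygraph3) → (Cell3 Π → Set) → Polygraph3
Π − X = record
  { P2 = Polygraph3.P2 Π
  ; C3 = λ s t → Σ (Polygraph3.C3 Π s t) λ α → ¬ X (cell α)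
  }

module _ (P : Polygraph2) where
  open Polygraph2 P
  open Free2 P

  Pt : ∀ {x y} → Path1 x y → Set
  Pt ε       = ⊤
  Pt (a ◅ u) = ℕ × Pt u

  _≤P_ : ∀ {x y} {u : Path1 x y} → Pt u → Pt u → Set
  _≤P_ {u = ε}     tt       tt       = ⊤
  _≤P_ {u = a ◅ u} (m , p) (n , q) = m ≤ n × _≤P_ {u = u} p q

  split : ∀ {x y z} (u : Path1 x y) {v : Path1 y z} → Pt (u ◅◅ v) → Pt u × Pt v
  split ε       p       = tt , p
  split (a ◅ u) (n , p) = (n , proj₁ (split u p)) , proj₂ (split u p)

  join : ∀ {x y z} (u : Path1 x y) {v : Path1 y z} → Pt u → Pt v → Pt (u ◅◅ v)
  join ε       tt      q = q
  join (a ◅ u) (n , p) q = n , join u p q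

  -- generating data of a polygraphic interpretation:
  --  φ on 1-cells: nonempty subsets of ℕ∖{0};
  --  φ on 2-cells: monotone maps φ(u) → φ(v);
  --  ∂ on 2-cells: monotone maps φ(u) → ℕ.
  record Interp1 : Set₁ where
    field
      Φ1     : ∀ {x y} → C1 x y → ℕ → Set
      Φ1-pos : ∀ {x y} (a : C1 x y) {n} → Φ1 a n → 1 ≤ n
      Φ1-ne  : ∀ {x y} (a : C1 x y) → Σ ℕ (Φ1 a)

    Φ : ∀ {x y} (u : Path1 x y) → Pt u → Set
    Φ ε       tt      = ⊤
    Φ (a ◅ u) (n , p) = Φ1 a n × Φ u p

  record Interp : Set₁ where
    field
      I1      : Interp1
    open Interp1 I1 public
    field
      Φ2      : ∀ {x y} {u v : Path1 x y} → C2 u v → Pt u → Pt v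
      Φ2-into : ∀ {x y} {u v : Path1 x y} (α : C2 u v) {p} → Φ u p → Φ v (Φ2 α p)
      Φ2-mono : ∀ {x y} {u v : Path1 x y} (α : C2 u v) {p q} → Φ u p → Φ u q →
                p ≤P q → Φ2 α p ≤P Φ2 α q
      ∂2      : ∀ {x y} {u v : Path1 x y} → C2 u v → Pt u → ℕ
      ∂2-mono : ∀ {x y} {u v : Path1 x y} (α : C2 u v) {p q} → Φ u p → Φ u q →
                p ≤P q → ∂2 α p ≤ ∂2 α q

    φ : ∀ {x y} {u v : Path1 x y} → Path2 u v → Pt u → Pt v
    φ (gen α)   p = Φ2 α p
    φ (id2 u)   p = p
    φ (f ⋆1 g)  p = φ g (φ f p)
    φ (_⋆0_ {u = u} f g) p = join _ (φ f (proj₁ (split u p))) (φ g (proj₂ (split u p)))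

    ∂ : ∀ {x y} {u v : Path1 x y} → Path2 u v → Pt u → ℕ
    ∂ (gen α)   p = ∂2 α p
    ∂ (id2 u)   p = 0
    ∂ (f ⋆1 g)  p = ∂ f p + ∂ g (φ f p)
    ∂ (_⋆0_ {u = u} f g) p = ∂ f (proj₁ (split u p)) + ∂ g (proj₂ (split u p))

module _ {Π : Polygraph3} (I : Interp (Polygraph3.P2 Π)) where
  open Interp I

  Compatible : Cell3 Π → Set
  Compatible (cell {u = u} {s = s} {t = t} α) =
    ∀ p → Φ u p → (_≤P_ (Polygraph3.P2 Π) (φ t p) (φ s p)) × ∂ s p ≥ ∂ t p

  StrictlyCompatible : Cell3 Π → Set
  StrictlyCompatible (cell {u = u} {s = s} {t = t} α) =
    ∀ p → Φ u p → (_≤P_ (Polygraph3.P2 Π) (φ t p) (φ s p)) × ∂ s p > ∂ t p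

-- A compatible interpretation yields the measure V F = ∂ F (p₀), for a fixed point p₀ of
-- φ of the 1-source of F. It is invariant under the axioms of strict 2-categories, and since
-- φ and ∂ are monotone and ∂ is additive, a rewriting step cannot increase it; a step by a
-- cell of X decreases it strictly. Hence an infinite Π-sequence uses X only finitely often,
-- and its tail is an infinite (Π − X)-sequence. Conversely every (Π − X)-step is a Π-step.
module Submission where

open import Defs
open import Data.Product using (Σ; _×_; _,_; proj₁; proj₂; uncurry)
open import Function.Base using (_∘_)
open import Function.Bundles using (_⇔_; mk⇔)
open import Data.Nat using (ℕ; zero; suc; _+_; _≤_; _<_; z≤n)
open import Data.Nat.Properties
  using ( ≤-refl; ≤-trans; <-≤-trans; ≤-pred; n<1+n; +-assoc; +-identityʳ
        ; +-mono-≤; +-mono-<-≤; +-mono-≤-<; +-commutativeSemigroup)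
open import Data.List using (List; []; _∷_; _++_; drop)
open import Data.List.Properties using (++-assoc; ++-identityʳ; drop-drop; drop-[])
open import Data.Unit using (tt)
open import Data.Empty using (⊥)
open import Relation.Nullary using (¬_)
open import Relation.Binary.Definitions using (Monotonic₂)
open import Relation.Binary.PropositionalEquality
  using (_≡_; refl; sym; trans; cong; cong₂; subst₂; _≗_; module ≡-Reasoning)
open import Relation.Binary.Construct.Closure.ReflexiveTransitive using (ε; _◅_; _◅◅_)
open import Relation.Binary.Construct.Closure.ReflexiveTransitive.Properties using (◅◅-assoc)
open import Algebra.Properties.CommutativeSemigroup +-commutativeSemigroup using (interchange)

module RelativeTermination {A : Set} where

  Chain : (A → A → Set) → Set
  Chain _⟶_ = Σ (ℕ → A) λ f → ∀ n → f n ⟶ f (suc n)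

  Chain-map : ∀ {_⟶_ _⟶'_ : A → A → Set} →
              (∀ {a b} → a ⟶ b → a ⟶' b) → Chain _⟶_ → Chain _⟶'_
  Chain-map embed (f , steps) = f , embed ∘ steps

  suffix : ∀ {_⟶_ : A → A → Set} → ℕ → Chain _⟶_ → Chain _⟶_
  suffix n (f , steps) = (λ m → f (m + n)) , (λ m → steps (m + n))

  module _ {_⟶_ _⟶'_ : A → A → Set} (V : A → ℕ)
           (V-antitone : ∀ {a b} → a ⟶ b → V b ≤ V a)
           (⟶'-unless-< : ∀ {a b} → a ⟶ b → ¬ V b < V a → a ⟶' b) where

    V-antitone-chain : (f : ℕ → A) → (∀ n → f n ⟶ f (suc n)) → ∀ n → V (f n) ≤ V (f 0)
    V-antitone-chain f steps zero    = ≤-refl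
    V-antitone-chain f steps (suc n) =
      ≤-trans (V-antitone (steps n)) (V-antitone-chain f steps n)

    -- A step of c that decreased V would start a suffix below N - 1, so by induction
    -- on N every step of c is a ⟶'-step.
    no-chain-below : ¬ Chain _⟶'_ → ∀ N (c : Chain _⟶_) → V (proj₁ c 0) < N → ⊥
    no-chain-below ⟶'-terminates (suc N) (f , steps) V<N = ⟶'-terminates (f , λ n →
      ⟶'-unless-< (steps n) λ V-drops →
        no-chain-below ⟶'-terminates N (suffix {_⟶_} (suc n) (f , steps))
          (<-≤-trans V-drops (≤-trans (V-antitone-chain f steps n) (≤-pred V<N))))

    terminates : ¬ Chain _⟶'_ → ¬ Chain _⟶_
    terminates ⟶'-terminates c = no-chain-below ⟶'-terminates _ c (n<1+n _)

module Points (P : Polygraph2) where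
  open Polygraph2 P
  open Free2 P

  length₁ : ∀ {x y} → Path1 x y → ℕ
  length₁ ε       = 0
  length₁ (_ ◅ u) = suc (length₁ u)

  length₁-◅◅ : ∀ {x y z} (u : Path1 x y) (v : Path1 y z) →
               length₁ (u ◅◅ v) ≡ length₁ u + length₁ v
  length₁-◅◅ ε       v = refl
  length₁-◅◅ (_ ◅ u) v = cong suc (length₁-◅◅ u v)

  ◅◅-identityʳ : ∀ {x y} (u : Path1 x y) → u ◅◅ ε ≡ u
  ◅◅-identityʳ ε       = refl
  ◅◅-identityʳ (a ◅ u) = cong (a ◅_) (◅◅-identityʳ u)

  toList : ∀ {x y} (u : Path1 x y) → Pt P u → List ℕ
  toList ε       tt      = []
  toList (_ ◅ u) (n , p) = n ∷ toList u p

  -- Lists that are too short are padded with 0; the padding is never observed.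
  fromList : ∀ {x y} (u : Path1 x y) → List ℕ → Pt P u
  fromList ε       _       = tt
  fromList (_ ◅ u) []      = 0 , fromList u []
  fromList (_ ◅ u) (n ∷ l) = n , fromList u l

  fromList-toList : ∀ {x y} (u : Path1 x y) p → fromList u (toList u p) ≡ p
  fromList-toList ε       tt      = refl
  fromList-toList (_ ◅ u) (n , p) = cong (n ,_) (fromList-toList u p)

  toList-join : ∀ {x y z} (u : Path1 x y) {v : Path1 y z} a b →
                toList (u ◅◅ v) (join P u a b) ≡ toList u a ++ toList v b
  toList-join ε       tt      b = refl
  toList-join (_ ◅ u) (n , a) b = cong (n ∷_) (toList-join u a b)

  split-fromList : ∀ {x y z} (u : Path1 x y) {v : Path1 y z} l →
                   split P u (fromList (u ◅◅ v) l) ≡ (fromList u l , fromList v (drop (length₁ u) l))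
  split-fromList ε           l       = refl
  split-fromList (_ ◅ u) {v} []      rewrite split-fromList u {v} [] =
    cong (λ l → (0 , fromList u []) , fromList v l) (drop-[] (length₁ u))
  split-fromList (_ ◅ u) {v} (n ∷ l) rewrite split-fromList u {v} l  = refl

  drop-◅◅ : ∀ {x y z} (u : Path1 x y) (v : Path1 y z) (l : List ℕ) →
            drop (length₁ (u ◅◅ v)) l ≡ drop (length₁ v) (drop (length₁ u) l)
  drop-◅◅ u v l = begin
    drop (length₁ (u ◅◅ v)) l               ≡⟨ cong (λ n → drop n l) (length₁-◅◅ u v) ⟩
    drop (length₁ u + length₁ v) l          ≡⟨ drop-drop (length₁ u) (length₁ v) l ⟨
    drop (length₁ v) (drop (length₁ u) l)   ∎
    where open ≡-Reasoning

  split-join : ∀ {x y z} (u : Path1 x y) {v : Path1 y z} a b → split P u {v} (join P u a b) ≡ (a , b)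
  split-join ε           tt      b = refl
  split-join (_ ◅ u) {v} (n , a) b rewrite split-join u {v} a b = refl

  join-split : ∀ {x y z} (u : Path1 x y) {v : Path1 y z} q → uncurry (join P u) (split P u {v} q) ≡ q
  join-split ε       q       = refl
  join-split (_ ◅ u) (n , q) = cong (n ,_) (join-split u q)

  infix 4 _≤ₚ_
  _≤ₚ_ : ∀ {x y} {u : Path1 x y} → Pt P u → Pt P u → Set
  _≤ₚ_ = _≤P_ P

  ≤ₚ-refl : ∀ {x y} (u : Path1 x y) (p : Pt P u) → p ≤ₚ p
  ≤ₚ-refl ε       tt      = tt
  ≤ₚ-refl (_ ◅ u) (n , p) = ≤-refl , ≤ₚ-refl u p

  ≤ₚ-split : ∀ {x y z} (u : Path1 x y) {v : Path1 y z} {p q} → p ≤ₚ q →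
             proj₁ (split P u {v} p) ≤ₚ proj₁ (split P u q) ×
             proj₂ (split P u {v} p) ≤ₚ proj₂ (split P u q)
  ≤ₚ-split ε       p≤q         = tt , p≤q
  ≤ₚ-split (_ ◅ u) (m≤n , p≤q) = (m≤n , proj₁ (≤ₚ-split u p≤q)) , proj₂ (≤ₚ-split u p≤q)

  ≤ₚ-join : ∀ {x y z} (u : Path1 x y) {v : Path1 y z} {a a' b b'} →
            a ≤ₚ a' → b ≤ₚ b' → join P u {v} a b ≤ₚ join P u a' b'
  ≤ₚ-join ε       tt           b≤b' = b≤b'
  ≤ₚ-join (_ ◅ u) (m≤n , a≤a') b≤b' = m≤n , ≤ₚ-join u a≤a' b≤b'

module Extension {P : Polygraph2} (I : Interp P) where
  open Polygraph2 P
  open Free2 P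
  open Points P
  open Interp I

  Φ-split : ∀ {x y z} (u : Path1 x y) {v : Path1 y z} {p} → Φ (u ◅◅ v) p →
            Φ u (proj₁ (split P u p)) × Φ v (proj₂ (split P u p))
  Φ-split ε       p∈Φ          = tt , p∈Φ
  Φ-split (_ ◅ u) (n∈Φ , p∈Φ) = (n∈Φ , proj₁ (Φ-split u p∈Φ)) , proj₂ (Φ-split u p∈Φ)

  Φ-join : ∀ {x y z} (u : Path1 x y) {v : Path1 y z} {a b} →
           Φ u a → Φ v b → Φ (u ◅◅ v) (join P u a b)
  Φ-join ε       tt           b∈Φ = b∈Φ
  Φ-join (_ ◅ u) (n∈Φ , a∈Φ) b∈Φ = n∈Φ , Φ-join u a∈Φ b∈Φ

  φ-into : ∀ {x y} {u v : Path1 x y} (f : Path2 u v) {p} → Φ u p → Φ v (φ f p)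
  φ-into (gen α)                p∈Φ = Φ2-into α p∈Φ
  φ-into (id2 u)                p∈Φ = p∈Φ
  φ-into (f ⋆1 g)               p∈Φ = φ-into g (φ-into f p∈Φ)
  φ-into (_⋆0_ {u = u} {v} f g) p∈Φ =
    Φ-join v (φ-into f (proj₁ (Φ-split u p∈Φ))) (φ-into g (proj₂ (Φ-split u p∈Φ)))

  φ-mono : ∀ {x y} {u v : Path1 x y} (f : Path2 u v) {p q} → Φ u p → Φ u q →
           p ≤ₚ q → φ f p ≤ₚ φ f q
  φ-mono (gen α)  p∈Φ q∈Φ p≤q = Φ2-mono α p∈Φ q∈Φ p≤q
  φ-mono (id2 u)  p∈Φ q∈Φ p≤q = p≤q
  φ-mono (f ⋆1 g) p∈Φ q∈Φ p≤q = φ-mono g (φ-into f p∈Φ) (φ-into f q∈Φ) (φ-mono f p∈Φ q∈Φ p≤q)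
  φ-mono (_⋆0_ {u = u} {v} f g) p∈Φ q∈Φ p≤q = ≤ₚ-join v
    (φ-mono f (proj₁ (Φ-split u p∈Φ)) (proj₁ (Φ-split u q∈Φ)) (proj₁ (≤ₚ-split u p≤q)))
    (φ-mono g (proj₂ (Φ-split u p∈Φ)) (proj₂ (Φ-split u q∈Φ)) (proj₂ (≤ₚ-split u p≤q)))

  ∂-mono : ∀ {x y} {u v : Path1 x y} (f : Path2 u v) {p q} → Φ u p → Φ u q →
           p ≤ₚ q → ∂ f p ≤ ∂ f q
  ∂-mono (gen α)  p∈Φ q∈Φ p≤q = ∂2-mono α p∈Φ q∈Φ p≤q
  ∂-mono (id2 u)  p∈Φ q∈Φ p≤q = z≤n
  ∂-mono (f ⋆1 g) p∈Φ q∈Φ p≤q = +-mono-≤ (∂-mono f p∈Φ q∈Φ p≤q)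
    (∂-mono g (φ-into f p∈Φ) (φ-into f q∈Φ) (φ-mono f p∈Φ q∈Φ p≤q))
  ∂-mono (_⋆0_ {u = u} f g) p∈Φ q∈Φ p≤q = +-mono-≤
    (∂-mono f (proj₁ (Φ-split u p∈Φ)) (proj₁ (Φ-split u q∈Φ)) (proj₁ (≤ₚ-split u p≤q)))
    (∂-mono g (proj₂ (Φ-split u p∈Φ)) (proj₂ (Φ-split u q∈Φ)) (proj₂ (≤ₚ-split u p≤q)))

  point : ∀ {x y} (u : Path1 x y) → Pt P u
  point ε       = tt
  point (a ◅ u) = proj₁ (Φ1-ne a) , point u

  point∈Φ : ∀ {x y} (u : Path1 x y) → Φ u (point u)
  point∈Φ ε       = tt
  point∈Φ (a ◅ u) = proj₂ (Φ1-ne a) , point∈Φ u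

-- Two 2-paths identified by ≈ may have 1-sources that are only propositionally
-- equal (u ◅◅ (v ◅◅ w) and (u ◅◅ v) ◅◅ w), so φ and ∂ are compared on lists.
module Invariance {P : Polygraph2} (I : Interp P) where
  open Polygraph2 P
  open Free2 P
  open Points P
  open Interp I
  open Extension I

  source : 2P → Σ C0 λ x → Σ C0 λ y → Path1 x y
  source F = 2P.x F , 2P.y F , 2P.u F

  φᴸ : 2P → List ℕ → List ℕ
  φᴸ (⟪_⟫ {u = u} {v} f) l = toList v (φ f (fromList u l))

  ∂ᴸ : 2P → List ℕ → ℕ
  ∂ᴸ (⟪_⟫ {u = u} f) l = ∂ f (fromList u l)

  infix 4 _∼_
  record _∼_ (F G : 2P) : Set where
    field
      source-≡ : source F ≡ source G
      φᴸ-≗     : φᴸ F ≗ φᴸ G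
      ∂ᴸ-≗     : ∂ᴸ F ≗ ∂ᴸ G
  open _∼_

  ∼-refl : ∀ {F} → F ∼ F
  ∼-refl = record { source-≡ = refl ; φᴸ-≗ = λ _ → refl ; ∂ᴸ-≗ = λ _ → refl }

  ∼-sym : ∀ {F G} → F ∼ G → G ∼ F
  ∼-sym F∼G = record
    { source-≡ = sym (source-≡ F∼G) ; φᴸ-≗ = sym ∘ φᴸ-≗ F∼G ; ∂ᴸ-≗ = sym ∘ ∂ᴸ-≗ F∼G }

  ∼-trans : ∀ {F G H} → F ∼ G → G ∼ H → F ∼ H
  ∼-trans F∼G G∼H = record
    { source-≡ = trans (source-≡ F∼G) (source-≡ G∼H)
    ; φᴸ-≗     = λ l → trans (φᴸ-≗ F∼G l) (φᴸ-≗ G∼H l)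
    ; ∂ᴸ-≗     = λ l → trans (∂ᴸ-≗ F∼G l) (∂ᴸ-≗ G∼H l)
    }

  ∼-pointwise : ∀ {x y} {u v : Path1 x y} {f g : Path2 u v} →
                (∀ p → φ f p ≡ φ g p) → (∀ p → ∂ f p ≡ ∂ g p) → ⟪ f ⟫ ∼ ⟪ g ⟫
  ∼-pointwise {v = v} φ-≡ ∂-≡ = record
    { source-≡ = refl ; φᴸ-≗ = λ _ → cong (toList v) (φ-≡ _) ; ∂ᴸ-≗ = λ _ → ∂-≡ _ }

  φᴸ-⋆1 : ∀ {x y} {u v w : Path1 x y} (f : Path2 u v) (g : Path2 v w) l →
          φᴸ ⟪ f ⋆1 g ⟫ l ≡ φᴸ ⟪ g ⟫ (φᴸ ⟪ f ⟫ l)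
  φᴸ-⋆1 {v = v} {w} f g l = cong (toList w ∘ φ g) (sym (fromList-toList v _))

  ∂ᴸ-⋆1 : ∀ {x y} {u v w : Path1 x y} (f : Path2 u v) (g : Path2 v w) l →
          ∂ᴸ ⟪ f ⋆1 g ⟫ l ≡ ∂ᴸ ⟪ f ⟫ l + ∂ᴸ ⟪ g ⟫ (φᴸ ⟪ f ⟫ l)
  ∂ᴸ-⋆1 {v = v} f g l = cong (λ p → ∂ᴸ ⟪ f ⟫ l + ∂ g p) (sym (fromList-toList v _))

  φᴸ-⋆0 : ∀ {x y z} {u v : Path1 x y} {p q : Path1 y z} (f : Path2 u v) (g : Path2 p q) l →
          φᴸ ⟪ f ⋆0 g ⟫ l ≡ φᴸ ⟪ f ⟫ l ++ φᴸ ⟪ g ⟫ (drop (length₁ u) l)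
  φᴸ-⋆0 {u = u} {v} {p} f g l rewrite split-fromList u {p} l = toList-join v _ _

  ∂ᴸ-⋆0 : ∀ {x y z} {u v : Path1 x y} {p q : Path1 y z} (f : Path2 u v) (g : Path2 p q) l →
          ∂ᴸ ⟪ f ⋆0 g ⟫ l ≡ ∂ᴸ ⟪ f ⟫ l + ∂ᴸ ⟪ g ⟫ (drop (length₁ u) l)
  ∂ᴸ-⋆0 {u = u} {p = p} f g l rewrite split-fromList u {p} l = refl

  ∼-⋆1 : ∀ {x y x' y'} {u v w : Path1 x y} {u' v' w' : Path1 x' y'}
           {f : Path2 u v} {g : Path2 v w} {f' : Path2 u' v'} {g' : Path2 v' w'} →
         ⟪ f ⟫ ∼ ⟪ f' ⟫ → ⟪ g ⟫ ∼ ⟪ g' ⟫ → ⟪ f ⋆1 g ⟫ ∼ ⟪ f' ⋆1 g' ⟫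
  ∼-⋆1 {f = f} {g} {f'} {g'} f∼f' g∼g' = record
    { source-≡ = source-≡ f∼f'
    ; φᴸ-≗     = λ l → begin
        φᴸ ⟪ f ⋆1 g ⟫ l           ≡⟨ φᴸ-⋆1 f g l ⟩
        φᴸ ⟪ g ⟫ (φᴸ ⟪ f ⟫ l)     ≡⟨ cong (φᴸ ⟪ g ⟫) (φᴸ-≗ f∼f' l) ⟩
        φᴸ ⟪ g ⟫ (φᴸ ⟪ f' ⟫ l)    ≡⟨ φᴸ-≗ g∼g' _ ⟩
        φᴸ ⟪ g' ⟫ (φᴸ ⟪ f' ⟫ l)   ≡⟨ φᴸ-⋆1 f' g' l ⟨
        φᴸ ⟪ f' ⋆1 g' ⟫ l         ∎
    ; ∂ᴸ-≗     = λ l → begin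
        ∂ᴸ ⟪ f ⋆1 g ⟫ l                          ≡⟨ ∂ᴸ-⋆1 f g l ⟩
        ∂ᴸ ⟪ f ⟫ l + ∂ᴸ ⟪ g ⟫ (φᴸ ⟪ f ⟫ l)       ≡⟨ cong₂ _+_ (∂ᴸ-≗ f∼f' l)
                                                               (cong (∂ᴸ ⟪ g ⟫) (φᴸ-≗ f∼f' l)) ⟩
        ∂ᴸ ⟪ f' ⟫ l + ∂ᴸ ⟪ g ⟫ (φᴸ ⟪ f' ⟫ l)     ≡⟨ cong (∂ᴸ ⟪ f' ⟫ l +_) (∂ᴸ-≗ g∼g' _) ⟩
        ∂ᴸ ⟪ f' ⟫ l + ∂ᴸ ⟪ g' ⟫ (φᴸ ⟪ f' ⟫ l)    ≡⟨ ∂ᴸ-⋆1 f' g' l ⟨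
        ∂ᴸ ⟪ f' ⋆1 g' ⟫ l                        ∎
    }
    where open ≡-Reasoning

  ∼-⋆0 : ∀ {x y z x' y' z'} {u v : Path1 x y} {p q : Path1 y z}
           {u' v' : Path1 x' y'} {p' q' : Path1 y' z'}
           {f : Path2 u v} {g : Path2 p q} {f' : Path2 u' v'} {g' : Path2 p' q'} →
         ⟪ f ⟫ ∼ ⟪ f' ⟫ → ⟪ g ⟫ ∼ ⟪ g' ⟫ → ⟪ f ⋆0 g ⟫ ∼ ⟪ f' ⋆0 g' ⟫
  ∼-⋆0 {f = f} {g} {f'} {g'} f∼f' g∼g' with source-≡ f∼f' | source-≡ g∼g'
  ... | refl | refl = record
    { source-≡ = refl
    ; φᴸ-≗     = λ l → trans (φᴸ-⋆0 f g l)
        (trans (cong₂ _++_ (φᴸ-≗ f∼f' l) (φᴸ-≗ g∼g' _)) (sym (φᴸ-⋆0 f' g' l)))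
    ; ∂ᴸ-≗     = λ l → trans (∂ᴸ-⋆0 f g l)
        (trans (cong₂ _+_ (∂ᴸ-≗ f∼f' l) (∂ᴸ-≗ g∼g' _)) (sym (∂ᴸ-⋆0 f' g' l)))
    }

  ∼-assoc0 : ∀ {x y z t} {u v : Path1 x y} {p q : Path1 y z} {r s : Path1 z t}
               (f : Path2 u v) (g : Path2 p q) (h : Path2 r s) →
             ⟪ (f ⋆0 g) ⋆0 h ⟫ ∼ ⟪ f ⋆0 (g ⋆0 h) ⟫
  ∼-assoc0 {x = x} {t = t} {u = u} {p = p} {r = r} f g h = record
    { source-≡ = cong (λ w → x , t , w) (◅◅-assoc u p r)
    ; φᴸ-≗     = φᴸ-assoc
    ; ∂ᴸ-≗     = ∂ᴸ-assoc
    }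
    where
    open ≡-Reasoning

    φᴸ-assoc : φᴸ ⟪ (f ⋆0 g) ⋆0 h ⟫ ≗ φᴸ ⟪ f ⋆0 (g ⋆0 h) ⟫
    φᴸ-assoc l = begin
      φᴸ ⟪ (f ⋆0 g) ⋆0 h ⟫ l                                ≡⟨ φᴸ-⋆0 (f ⋆0 g) h l ⟩
      φᴸ ⟪ f ⋆0 g ⟫ l ++ φᴸ ⟪ h ⟫ (drop (length₁ (u ◅◅ p)) l) ≡⟨ cong₂ _++_ (φᴸ-⋆0 f g l)
                                                                   (cong (φᴸ ⟪ h ⟫) (drop-◅◅ u p l)) ⟩
      (φᴸ ⟪ f ⟫ l ++ φᴸ ⟪ g ⟫ l₁) ++ φᴸ ⟪ h ⟫ l₂              ≡⟨ ++-assoc (φᴸ ⟪ f ⟫ l) _ _ ⟩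
      φᴸ ⟪ f ⟫ l ++ (φᴸ ⟪ g ⟫ l₁ ++ φᴸ ⟪ h ⟫ l₂)              ≡⟨ cong (φᴸ ⟪ f ⟫ l ++_) (φᴸ-⋆0 g h l₁) ⟨
      φᴸ ⟪ f ⟫ l ++ φᴸ ⟪ g ⋆0 h ⟫ l₁                          ≡⟨ φᴸ-⋆0 f (g ⋆0 h) l ⟨
      φᴸ ⟪ f ⋆0 (g ⋆0 h) ⟫ l                                ∎
      where l₁ = drop (length₁ u) l ; l₂ = drop (length₁ p) l₁

    ∂ᴸ-assoc : ∂ᴸ ⟪ (f ⋆0 g) ⋆0 h ⟫ ≗ ∂ᴸ ⟪ f ⋆0 (g ⋆0 h) ⟫
    ∂ᴸ-assoc l = begin
      ∂ᴸ ⟪ (f ⋆0 g) ⋆0 h ⟫ l                               ≡⟨ ∂ᴸ-⋆0 (f ⋆0 g) h l ⟩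
      ∂ᴸ ⟪ f ⋆0 g ⟫ l + ∂ᴸ ⟪ h ⟫ (drop (length₁ (u ◅◅ p)) l) ≡⟨ cong₂ _+_ (∂ᴸ-⋆0 f g l)
                                                                 (cong (∂ᴸ ⟪ h ⟫) (drop-◅◅ u p l)) ⟩
      (∂ᴸ ⟪ f ⟫ l + ∂ᴸ ⟪ g ⟫ l₁) + ∂ᴸ ⟪ h ⟫ l₂               ≡⟨ +-assoc (∂ᴸ ⟪ f ⟫ l) _ _ ⟩
      ∂ᴸ ⟪ f ⟫ l + (∂ᴸ ⟪ g ⟫ l₁ + ∂ᴸ ⟪ h ⟫ l₂)               ≡⟨ cong (∂ᴸ ⟪ f ⟫ l +_) (∂ᴸ-⋆0 g h l₁) ⟨
      ∂ᴸ ⟪ f ⟫ l + ∂ᴸ ⟪ g ⋆0 h ⟫ l₁                          ≡⟨ ∂ᴸ-⋆0 f (g ⋆0 h) l ⟨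
      ∂ᴸ ⟪ f ⋆0 (g ⋆0 h) ⟫ l                               ∎
      where l₁ = drop (length₁ u) l ; l₂ = drop (length₁ p) l₁

  ∼-unitr0 : ∀ {x y} {u v : Path1 x y} (f : Path2 u v) → ⟪ f ⋆0 id2 (ε {x = y}) ⟫ ∼ ⟪ f ⟫
  ∼-unitr0 {x} {y} {u} f = record
    { source-≡ = cong (λ w → x , y , w) (◅◅-identityʳ u)
    ; φᴸ-≗     = λ l → trans (φᴸ-⋆0 f (id2 ε) l) (++-identityʳ _)
    ; ∂ᴸ-≗     = λ l → trans (∂ᴸ-⋆0 f (id2 ε) l) (+-identityʳ _)
    }

  ∼-exch : ∀ {x y z} {u v w : Path1 x y} {p q r : Path1 y z}
             (f : Path2 u v) (f' : Path2 v w) (g : Path2 p q) (g' : Path2 q r) →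
           ⟪ (f ⋆0 g) ⋆1 (f' ⋆0 g') ⟫ ∼ ⟪ (f ⋆1 f') ⋆0 (g ⋆1 g') ⟫
  ∼-exch {u = u} {v} {w} {p} {q} f f' g g' = ∼-pointwise
    (λ _ → cong (uncurry λ a b → join P w (φ f' a) (φ g' b)) (split-join v _ _))
    (λ m → let a = proj₁ (split P u {p} m) ; b = proj₂ (split P u {p} m) in
      trans (cong (uncurry λ a' b' → (∂ f a + ∂ g b) + (∂ f' a' + ∂ g' b')) (split-join v {q} _ _))
            (interchange (∂ f a) (∂ g b) _ _))

  ≈⇒∼ : ∀ {F G} → F ≈ G → F ∼ G
  ≈⇒∼ ≈-refl                        = ∼-refl
  ≈⇒∼ (≈-sym F≈G)                   = ∼-sym (≈⇒∼ F≈G)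
  ≈⇒∼ (≈-trans F≈G G≈H)             = ∼-trans (≈⇒∼ F≈G) (≈⇒∼ G≈H)
  ≈⇒∼ (cong⋆1 f≈f' g≈g')            = ∼-⋆1 (≈⇒∼ f≈f') (≈⇒∼ g≈g')
  ≈⇒∼ (cong⋆0 f≈f' g≈g')            = ∼-⋆0 (≈⇒∼ f≈f') (≈⇒∼ g≈g')
  ≈⇒∼ (assoc1 {f = f})              = ∼-pointwise (λ _ → refl) (λ p → +-assoc (∂ f p) _ _)
  ≈⇒∼ unitl1                        = ∼-pointwise (λ _ → refl) (λ _ → refl)
  ≈⇒∼ unitr1                        = ∼-pointwise (λ _ → refl) (λ _ → +-identityʳ _)
  ≈⇒∼ (assoc0 {f = f} {g} {h})      = ∼-assoc0 f g h
  ≈⇒∼ unitl0                        = ∼-pointwise (λ _ → refl) (λ _ → refl)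
  ≈⇒∼ (unitr0 {f = f})              = ∼-unitr0 f
  ≈⇒∼ (id⋆0 {u = u})                = ∼-pointwise (join-split u) (λ _ → refl)
  ≈⇒∼ (exch {f = f} {f'} {g} {g'})  = ∼-exch f f' g g'

  V : 2P → ℕ
  V (⟪_⟫ {u = u} f) = ∂ f (point u)

  ∼⇒V≡ : ∀ {F G} → F ∼ G → V F ≡ V G
  ∼⇒V≡ {⟪_⟫ {u = u} f} {⟪ g ⟫} F∼G with source-≡ F∼G
  ... | refl = begin
    ∂ f (point u)                    ≡⟨ cong (∂ f) (fromList-toList u _) ⟨
    ∂ᴸ ⟪ f ⟫ (toList u (point u))    ≡⟨ ∂ᴸ-≗ F∼G _ ⟩
    ∂ᴸ ⟪ g ⟫ (toList u (point u))    ≡⟨ cong (∂ g) (fromList-toList u _) ⟩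
    ∂ g (point u)                    ∎
    where open ≡-Reasoning

module Domination {P : Polygraph2} (I : Interp P) {_R_ : ℕ → ℕ → Set}
  (+-mono-R-≤ : Monotonic₂ _R_ _≤_ _R_ _+_)
  (+-mono-≤-R : Monotonic₂ _≤_ _R_ _R_ _+_) where
  open Polygraph2 P
  open Free2 P
  open Points P
  open Interp I
  open Extension I

  -- For R = _≤_ (resp. _<_) this is Compatible (resp. StrictlyCompatible) of a 3-cell s ⇛ t.
  Dominates : ∀ {x y} {u v : Path1 x y} → Path2 u v → Path2 u v → Set
  Dominates {u = u} s t = ∀ p → Φ u p → φ t p ≤ₚ φ s p × ∂ t p R ∂ s p

  Dominates-whisk : ∀ {x' x y y'} (w : Path1 x' x) {u v : Path1 x y} {s t : Path2 u v} (w' : Path1 y y') →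
                    Dominates s t → Dominates (whisk w s w') (whisk w t w')
  Dominates-whisk w {u} {v} w' s≥t q q∈Φ =
    let m∈Φ = proj₁ (Φ-split u (proj₂ (Φ-split w q∈Φ)))
        (φt≤φs , ∂t-R-∂s) = s≥t _ m∈Φ
    in ≤ₚ-join w (≤ₚ-refl w _) (≤ₚ-join v φt≤φs (≤ₚ-refl w' _)) , +-mono-R-≤ ∂t-R-∂s z≤n

  Dominates-⋆1ˡ : ∀ {x y} {r u v : Path1 x y} (h : Path2 r u) {s t : Path2 u v} →
                  Dominates s t → Dominates (h ⋆1 s) (h ⋆1 t)
  Dominates-⋆1ˡ h s≥t p p∈Φ =
    let (φt≤φs , ∂t-R-∂s) = s≥t (φ h p) (φ-into h p∈Φ)
    in φt≤φs , +-mono-≤-R (≤-refl {∂ h p}) ∂t-R-∂s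

  Dominates-⋆1ʳ : ∀ {x y} {u v r : Path1 x y} {s t : Path2 u v} →
                  Dominates s t → (k : Path2 v r) → Dominates (s ⋆1 k) (t ⋆1 k)
  Dominates-⋆1ʳ {s = s} {t} s≥t k p p∈Φ =
    let (φt≤φs , ∂t-R-∂s) = s≥t p p∈Φ
    in φ-mono k (φ-into t p∈Φ) (φ-into s p∈Φ) φt≤φs ,
       +-mono-R-≤ ∂t-R-∂s (∂-mono k (φ-into t p∈Φ) (φ-into s p∈Φ) φt≤φs)

  Dominates-in-context :
    ∀ {x' x y y'} {u v : Path1 x y} {s t : Path2 u v} (w : Path1 x' x) (w' : Path1 y y')
      {r r' : Path1 x' y'} (h : Path2 r (w ◅◅ u ◅◅ w')) (k : Path2 (w ◅◅ v ◅◅ w') r') →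
    Dominates s t → Dominates (h ⋆1 whisk w s w' ⋆1 k) (h ⋆1 whisk w t w' ⋆1 k)
  Dominates-in-context {s = s} {t} w w' h k s≥t =
    Dominates-⋆1ʳ {s = h ⋆1 whisk w s w'} {h ⋆1 whisk w t w'}
      (Dominates-⋆1ˡ h {whisk w s w'} {whisk w t w'} (Dominates-whisk w {s = s} {t} w' s≥t)) k

module _ {Π : Polygraph3} (I : Interp (Polygraph3.P2 Π)) {_R_ : ℕ → ℕ → Set}
         (+-mono-R-≤ : Monotonic₂ _R_ _≤_ _R_ _+_)
         (+-mono-≤-R : Monotonic₂ _≤_ _R_ _R_ _+_) where
  open Polygraph3 Π
  open Free2 P2
  open Extension I
  open Invariance I
  open Domination I {_R_} +-mono-R-≤ +-mono-≤-R

  V-step : ∀ {F G} (st : Step Π F G) → Dominates (Step.s st) (Step.t st) → V G R V F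
  V-step st s≥t = subst₂ _R_ (∼⇒V≡ (≈⇒∼ (≈-sym tgt≈))) (∼⇒V≡ (≈⇒∼ (≈-sym src≈)))
    (proj₂ (Dominates-in-context {s = s} {t} w w' h k s≥t (point r) (point∈Φ r)))
    where open Step st

module _ {Π : Polygraph3} (X : Cell3 Π → Set) where

  Step-weaken : ∀ {F G} → Step (Π − X) F G → Step Π F G
  Step-weaken st = record { Step st using (w; w'; h; k; src≈; tgt≈) ; α = proj₁ (Step.α st) }

  Step-restrict : ∀ {F G} (st : Step Π F G) → ¬ X (cell (Step.α st)) → Step (Π − X) F G
  Step-restrict st α∉X = record { Step st using (w; w'; h; k; src≈; tgt≈) ; α = Step.α st , α∉X }

open RelativeTermination

proposition2p28 : (Π : Polygraph3) (X : Cell3 Π → Set) →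
    Σ (Interp (Polygraph3.P2 Π)) (λ I →
        ((c : Cell3 Π) → Compatible I c) ×
        ((c : Cell3 Π) → X c → StrictlyCompatible I c)) →
    Terminates Π ⇔ Terminates (Π − X)
proposition2p28 Π X (I , compatible , strictly-compatible) = mk⇔
  (λ Π-terminates → Π-terminates ∘ Chain-map {_⟶_ = Step (Π − X)} (Step-weaken X))
  (terminates {_⟶_ = Step Π} {_⟶'_ = Step (Π − X)} V V-antitone step-unless-<)
  where
  open Invariance I using (V)

  V-antitone : ∀ {F G} → Step Π F G → V G ≤ V F
  V-antitone st = V-step I {_≤_} +-mono-≤ +-mono-≤ st (compatible (cell (Step.α st)))

  step-unless-< : ∀ {F G} (st : Step Π F G) → ¬ V G < V F → Step (Π − X) F G
  step-unless-< st V-steady = Step-restrict X st λ α∈X →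
    V-steady (V-step I {_<_} +-mono-<-≤ +-mono-≤-< st (strictly-compatible (cell (Step.α st)) α∈X))
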